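{- For every graph $G$: (1) $\mathrm{cdeg}(G)\le\widetilde{\omega}(G)\cdot(\mathrm{cideg}(G)-1)$; (2) $\widetilde{\omega}(G)\le 2^{\mathrm{cdeg}(G)}$; (3) $\mathrm{cideg}(G)\le\mathrm{cdeg}(G)+1$.
   Context: All graphs finite and simple. $\mathrm{cdeg}(G)$ (clique-degree) is the maximum degree of the graph whose vertices are the maximal cliques of $G$, two distinct maximal cliques adjacent iff they intersect. $\mathrm{cideg}(G)$ is the maximum over vertices of the number of maximal cliques containing that vertex. Two vertices are equivalent if they lie in exactly the same maximal cliques; $\widetilde{\omega}(G)$ is the maximum, over maximal cliques $K$, of the number of equivalence classes intersecting $K$. -}

module Defs where

open import Data.Nat using (ℕ; zero; suc; _⊔_)
open import Data.Bool using (Bool; true; false)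
import Data.Bool.Properties as BoolP
open import Data.Fin using (Fin)
open import Data.Fin.Properties using (all?; any?; _≟_)
open import Data.Fin.Subset using (Subset; _∈_; _⊆_; _∩_; Nonempty; inside; outside)
open import Data.Fin.Subset.Properties using (_∈?_; _⊆?_; anySubset?; nonempty?)
open import Data.Vec using (Vec; []; _∷_; tabulate)
open import Data.Vec.Properties using (≡-dec)
open import Data.List using (List; []; _∷_; _++_; map; filter; length; foldr; allFin)
open import Data.Product using (Σ; ∃; _×_; _,_)
open import Relation.Nullary using (Dec; yes; no; ¬_; ¬?)
open import Relation.Nullary.Decidable using (_×-dec_; _→-dec_)
open import Relation.Binary.PropositionalEquality using (_≡_; _≢_)

record Graph (n : ℕ) : Set where
  field
    adj    : Fin n → Fin n → Bool
    sym    : ∀ i j → adj i j ≡ adj j i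
    irrefl : ∀ i → adj i i ≡ false
open Graph public

allSubsets : (n : ℕ) → List (Subset n)
allSubsets zero    = [] ∷ []
allSubsets (suc n) = map (outside ∷_) (allSubsets n) ++ map (inside ∷_) (allSubsets n)

_≟ˢ_ : ∀ {n} (p q : Subset n) → Dec (p ≡ q)
_≟ˢ_ = ≡-dec BoolP._≟_

allSubset? : ∀ {n} {P : Subset n → Set} → (∀ p → Dec (P p)) → Dec (∀ p → P p)
allSubset? {n} {P} P? with anySubset? (λ p → ¬? (P? p))
... | yes (p , ¬Pp) = no (λ ∀P → ¬Pp (∀P p))
... | no ¬∃ = yes (λ p → dec p (P? p) ¬∃)
  where
  dec : ∀ p → Dec (P p) → ¬ (∃ λ q → ¬ P q) → P p
  dec p (yes Pp) _  = Pp
  dec p (no ¬Pp) ¬∃′ with ¬∃′ (p , ¬Pp)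
  ... | ()

maxList : List ℕ → ℕ
maxList = foldr _⊔_ 0

module _ {n : ℕ} (G : Graph n) where

  IsClique : Subset n → Set
  IsClique K = ∀ i j → i ∈ K → j ∈ K → i ≢ j → adj G i j ≡ true

  isClique? : ∀ K → Dec (IsClique K)
  isClique? K = all? λ i → all? λ j →
    (i ∈? K) →-dec (j ∈? K) →-dec ¬? (i ≟ j) →-dec (adj G i j BoolP.≟ true)

  IsMaximalClique : Subset n → Set
  IsMaximalClique K = IsClique K × (∀ K′ → IsClique K′ → K ⊆ K′ → K′ ≡ K)

  isMaximalClique? : ∀ K → Dec (IsMaximalClique K)
  isMaximalClique? K = isClique? K ×-dec
    allSubset? (λ K′ → isClique? K′ →-dec (K ⊆? K′) →-dec (K′ ≟ˢ K))

  maximalCliques : List (Subset n)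
  maximalCliques = filter isMaximalClique? (allSubsets n)

  -- clique-degree: maximum degree in the clique graph
  -- (vertices = maximal cliques, distinct ones adjacent iff they meet)

  cliqueGraphDegree : Subset n → ℕ
  cliqueGraphDegree K =
    length (filter (λ K′ → ¬? (K′ ≟ˢ K) ×-dec nonempty? (K ∩ K′)) maximalCliques)

  cdeg : ℕ
  cdeg = maxList (map cliqueGraphDegree maximalCliques)

  cliquesAt : Fin n → ℕ
  cliquesAt v = length (filter (λ K → v ∈? K) maximalCliques)

  cideg : ℕ
  cideg = maxList (map cliquesAt (allFin n))

  Equiv : Fin n → Fin n → Set
  Equiv u v = ∀ K → IsMaximalClique K → (u ∈ K → v ∈ K) × (v ∈ K → u ∈ K)

  equiv? : ∀ u v → Dec (Equiv u v)
  equiv? u v = allSubset? λ K → isMaximalClique? K →-dec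
    (((u ∈? K) →-dec (v ∈? K)) ×-dec ((v ∈? K) →-dec (u ∈? K)))

  eqClass : Fin n → Subset n
  eqClass v = tabulate λ u → Relation.Nullary.does (equiv? u v)
    where import Relation.Nullary

  IsClassMeeting : Subset n → Subset n → Set
  IsClassMeeting K S = ∃ λ v → v ∈ K × S ≡ eqClass v

  isClassMeeting? : ∀ K S → Dec (IsClassMeeting K S)
  isClassMeeting? K S = any? λ v → (v ∈? K) ×-dec (S ≟ˢ eqClass v)

  classesMeeting : Subset n → ℕ
  classesMeeting K = length (filter (isClassMeeting? K) (allSubsets n))

  ω̃ : ℕ
  ω̃ = maxList (map classesMeeting maximalCliques)

-- Fix a maximal clique K with clique-graph neighbourhood N(K). Being equivalent to a vertex v
-- means lying in every maximal clique through v, so the class of v is contained in each of them.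
-- (3) The maximal cliques through v ∈ K are K and members of N(K).
-- (1) A neighbour K′ meets K in some w, so K′ is one of the at most cideg − 1 maximal cliques
-- other than K containing the class of w; there are ω̃ choices for that class.
-- (2) A class meeting K lies in K and in exactly those K′ ∈ N(K) that meet it, so it is
-- determined by which members of N(K) contain it: at most 2^|N(K)| classes.
module Submission where

open import Defs
open import Data.Nat using (ℕ; _≤_; _*_; _∸_; _^_; _+_)
open import Data.Product using (_×_)

open import Data.Nat using (zero; suc; _<_; z≤n; s≤s)
open import Data.Bool using (true)
open import Data.Empty using (⊥)
open import Data.Fin using (Fin)
open import Data.Fin.Subset using (Subset; _∈_; _⊆_; _∩_; inside; outside)
open import Data.Fin.Subset.Properties using (_∈?_; _⊆?_; x∈p∩q⁺; x∈p∩q⁻; nonempty?)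
open import Data.List as List using (List; []; _∷_; _++_; map; filter; length; concatMap)
open import Data.List.Properties using (length-++; length-map; filter-notAll)
open import Data.List.Membership.Propositional using () renaming (_∈_ to _∈ₗ_)
open import Data.List.Membership.Propositional.Properties
  using (∈-filter⁺; ∈-filter⁻; ∈-allFin; ∈-map⁺; ∈-map⁻; ∈-++⁺ˡ; ∈-++⁺ʳ; ∈-concat⁺′)
open import Data.List.Relation.Binary.Subset.Propositional using () renaming (_⊆_ to _⊆ₗ_)
open import Data.List.Relation.Unary.All as All using ([])
open import Data.List.Relation.Unary.AllPairs using ([]; _∷_)
open import Data.List.Relation.Unary.Any as Any using (here; there)
open import Data.List.Relation.Unary.Any.Properties using (lookup-index)
open import Data.List.Relation.Unary.Unique.Propositional using (Unique)
import Data.List.Relation.Unary.Unique.Propositional.Properties as Unique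
open import Data.Nat.Properties
open import Data.Product using (_,_; proj₁; proj₂)
import Data.Vec as Vec
open import Data.Vec.Properties using (lookup∘tabulate; tabulate-cong; []=⇒lookup; lookup⇒[]=)
open import Function using (id; _∘_)
open import Function.Bundles using (mk⇔)
open import Relation.Binary.Definitions using (DecidableEquality)
open import Relation.Binary.PropositionalEquality
  using (_≡_; _≢_; refl; trans; cong; cong₂; module ≡-Reasoning)
  renaming (sym to ≡-sym)
open import Relation.Nullary using (Dec; yes; no; does; ¬?)
open import Relation.Nullary.Decidable using (_×-dec_; dec-true; does-⇔)

does≡true⇒ : ∀ {A : Set} (a? : Dec A) → does a? ≡ true → A
does≡true⇒ (yes a) _ = a
does≡true⇒ (no _) ()

module _ {A : Set} (_≟_ : DecidableEquality A) where

  length-filter-≢-< : ∀ {x xs} → x ∈ₗ xs →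
    length (filter (λ y → ¬? (y ≟ x)) xs) < length xs
  length-filter-≢-< {xs = xs} x∈xs =
    filter-notAll _ xs (Any.map (λ x≡y y≢x → y≢x (≡-sym x≡y)) x∈xs)

module _ {A B : Set} (_≟_ : DecidableEquality B) where

  length-≤-injection : ∀ {xs : List A} {ys : List B} (f : A → B) → Unique xs →
    (∀ {x} → x ∈ₗ xs → f x ∈ₗ ys) →
    (∀ {x y} → x ∈ₗ xs → y ∈ₗ xs → f x ≡ f y → x ≡ y) →
    length xs ≤ length ys
  length-≤-injection {[]}     f _              _    _   = z≤n
  length-≤-injection {x ∷ xs} {ys} f (x∉xs ∷ xs!) into inj =
    ≤-trans (s≤s (length-≤-injection f xs! into′ (λ p q → inj (there p) (there q))))
            (length-filter-≢-< _≟_ (into (here refl)))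
    where
    into′ : ∀ {y} → y ∈ₗ xs → f y ∈ₗ filter (λ z → ¬? (z ≟ f x)) ys
    into′ y∈xs = ∈-filter⁺ _ (into (there y∈xs))
      (λ fy≡fx → All.lookup x∉xs y∈xs (≡-sym (inj (there y∈xs) (here refl) fy≡fx)))

unique-⊆⇒length-≤ : ∀ {A : Set} → DecidableEquality A → {xs ys : List A} →
  Unique xs → xs ⊆ₗ ys → length xs ≤ length ys
unique-⊆⇒length-≤ _≟_ xs! xs⊆ys = length-≤-injection _≟_ id xs! xs⊆ys (λ _ _ → id)

length-concatMap-≤ : ∀ {A B : Set} (f : A → List B) (c : ℕ) (xs : List A) →
  (∀ {x} → x ∈ₗ xs → length (f x) ≤ c) → length (concatMap f xs) ≤ length xs * c
length-concatMap-≤ f c []       _     = z≤n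
length-concatMap-≤ f c (x ∷ xs) bound = begin
  length (f x ++ concatMap f xs)          ≡⟨ length-++ (f x) ⟩
  length (f x) + length (concatMap f xs)  ≤⟨ +-mono-≤ (bound (here refl))
                                               (length-concatMap-≤ f c xs (bound ∘ there)) ⟩
  c + length xs * c                       ∎
  where open ≤-Reasoning

length-≤-if-members-≤ : ∀ {A : Set} {xs : List A} {m} →
  (∀ {x} → x ∈ₗ xs → length xs ≤ m) → length xs ≤ m
length-≤-if-members-≤ {xs = []}    _     = z≤n
length-≤-if-members-≤ {xs = _ ∷ _} bound = bound (here refl)

≤-maxList : ∀ {A : Set} (f : A → ℕ) {x xs} → x ∈ₗ xs → f x ≤ maxList (map f xs)
≤-maxList f (here refl) = m≤m⊔n _ _
≤-maxList f (there x∈) = ≤-trans (≤-maxList f x∈) (m≤n⊔m _ _)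

maxList-≤ : ∀ {A : Set} (f : A → ℕ) (xs : List A) {m} → (∀ {x} → x ∈ₗ xs → f x ≤ m) →
  maxList (map f xs) ≤ m
maxList-≤ f []       _     = z≤n
maxList-≤ f (x ∷ xs) bound = ⊔-lub (bound (here refl)) (maxList-≤ f xs (bound ∘ there))

∈-allSubsets : ∀ n (p : Subset n) → p ∈ₗ allSubsets n
∈-allSubsets zero    Vec.[]          = here refl
∈-allSubsets (suc n) (outside Vec.∷ p) = ∈-++⁺ˡ (∈-map⁺ (outside Vec.∷_) (∈-allSubsets n p))
∈-allSubsets (suc n) (inside Vec.∷ p)  =
  ∈-++⁺ʳ (map (outside Vec.∷_) (allSubsets n)) (∈-map⁺ (inside Vec.∷_) (∈-allSubsets n p))

allSubsets-unique : ∀ n → Unique (allSubsets n)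
allSubsets-unique zero    = [] ∷ []
allSubsets-unique (suc n) =
  Unique.++⁺ (Unique.map⁺ ∷-injectiveʳ (allSubsets-unique n))
             (Unique.map⁺ ∷-injectiveʳ (allSubsets-unique n))
             heads-differ
  where
  ∷-injectiveʳ : ∀ {b} {p q : Subset n} → b Vec.∷ p ≡ b Vec.∷ q → p ≡ q
  ∷-injectiveʳ refl = refl
  heads-differ : ∀ {p} → p ∈ₗ map (outside Vec.∷_) (allSubsets n) ×
                          p ∈ₗ map (inside Vec.∷_) (allSubsets n) → ⊥
  heads-differ (p∈ , p∈′) with ∈-map⁻ (outside Vec.∷_) p∈ | ∈-map⁻ (inside Vec.∷_) p∈′
  ... | _ , _ , refl | _ , _ , ()

length-allSubsets : ∀ n → length (allSubsets n) ≡ 2 ^ n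
length-allSubsets zero    = refl
length-allSubsets (suc n) = begin
  length (map (outside Vec.∷_) subsets ++ map (inside Vec.∷_) subsets)
    ≡⟨ length-++ (map (outside Vec.∷_) subsets) ⟩
  length (map (outside Vec.∷_) subsets) + length (map (inside Vec.∷_) subsets)
    ≡⟨ cong₂ _+_ (length-map _ subsets) (length-map _ subsets) ⟩
  length subsets + length subsets
    ≡⟨ cong (λ k → k + k) (length-allSubsets n) ⟩
  2 ^ n + 2 ^ n
    ≡⟨ cong (2 ^ n +_) (≡-sym (+-identityʳ _)) ⟩
  2 ^ suc n ∎
  where
  open ≡-Reasoning
  subsets = allSubsets n

module _ {n : ℕ} (G : Graph n) where

  ∈-maximalCliques⁺ : ∀ {K} → IsMaximalClique G K → K ∈ₗ maximalCliques G
  ∈-maximalCliques⁺ {K} K-max = ∈-filter⁺ (isMaximalClique? G) (∈-allSubsets n K) K-max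

  ∈-maximalCliques⁻ : ∀ {K} → K ∈ₗ maximalCliques G → IsMaximalClique G K
  ∈-maximalCliques⁻ K∈ = proj₂ (∈-filter⁻ (isMaximalClique? G) {xs = allSubsets n} K∈)

  maximalCliques-unique : Unique (maximalCliques G)
  maximalCliques-unique = Unique.filter⁺ (isMaximalClique? G) (allSubsets-unique n)

  Equiv-refl : ∀ v → Equiv G v v
  Equiv-refl v K _ = id , id

  Equiv-sym : ∀ {u v} → Equiv G u v → Equiv G v u
  Equiv-sym u~v K K-max = proj₂ (u~v K K-max) , proj₁ (u~v K K-max)

  Equiv-trans : ∀ {u v w} → Equiv G u v → Equiv G v w → Equiv G u w
  Equiv-trans u~v v~w K K-max =
    proj₁ (v~w K K-max) ∘ proj₁ (u~v K K-max) , proj₂ (u~v K K-max) ∘ proj₂ (v~w K K-max)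

  v∈eqClass[v] : ∀ v → v ∈ eqClass G v
  v∈eqClass[v] v = lookup⇒[]= v (eqClass G v)
    (trans (lookup∘tabulate _ v) (dec-true (equiv? G v v) (Equiv-refl v)))

  ∈-eqClass⁻ : ∀ {u v} → u ∈ eqClass G v → Equiv G u v
  ∈-eqClass⁻ {u} {v} u∈ =
    does≡true⇒ (equiv? G u v) (trans (≡-sym (lookup∘tabulate _ u)) ([]=⇒lookup u∈))

  eqClass-⊆ : ∀ {K v} → IsMaximalClique G K → v ∈ K → eqClass G v ⊆ K
  eqClass-⊆ {K} K-max v∈K u∈ = proj₂ (∈-eqClass⁻ u∈ K K-max) v∈K

  eqClass-cong : ∀ {v w} → Equiv G v w → eqClass G v ≡ eqClass G w
  eqClass-cong {v} {w} v~w = tabulate-cong λ u →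
    does-⇔ (mk⇔ (λ u~v → Equiv-trans u~v v~w) (λ u~w → Equiv-trans u~w (Equiv-sym v~w)))
           (equiv? G u v) (equiv? G u w)

  neighbours : Subset n → List (Subset n)
  neighbours K = filter (λ K′ → ¬? (K′ ≟ˢ K) ×-dec nonempty? (K ∩ K′)) (maximalCliques G)

  ∈-neighbours⁺ : ∀ {K K′ v} → IsMaximalClique G K′ → K′ ≢ K → v ∈ K → v ∈ K′ →
    K′ ∈ₗ neighbours K
  ∈-neighbours⁺ K′-max K′≢K v∈K v∈K′ =
    ∈-filter⁺ _ (∈-maximalCliques⁺ K′-max) (K′≢K , _ , x∈p∩q⁺ (v∈K , v∈K′))

  cliquesThrough : Fin n → List (Subset n)
  cliquesThrough v = filter (v ∈?_) (maximalCliques G)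

  cliquesContaining : Subset n → List (Subset n)
  cliquesContaining S = filter (S ⊆?_) (maximalCliques G)

  classes : Subset n → List (Subset n)
  classes K = filter (isClassMeeting? G K) (allSubsets n)

  ∈-classes⁻ : ∀ {K S} → S ∈ₗ classes K → IsClassMeeting G K S
  ∈-classes⁻ {K} S∈ = proj₂ (∈-filter⁻ (isClassMeeting? G K) {xs = allSubsets n} S∈)

  cliquesAt≤1+cliqueGraphDegree : ∀ {v K} → K ∈ₗ cliquesThrough v →
    cliquesAt G v ≤ suc (cliqueGraphDegree G K)
  cliquesAt≤1+cliqueGraphDegree {v} {K} K∈ =
    unique-⊆⇒length-≤ _≟ˢ_ (Unique.filter⁺ _ maximalCliques-unique) through⊆K∷neighbours
    where
    v∈K : v ∈ K
    v∈K = proj₂ (∈-filter⁻ (v ∈?_) {xs = maximalCliques G} K∈)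
    through⊆K∷neighbours : cliquesThrough v ⊆ₗ K ∷ neighbours K
    through⊆K∷neighbours {K′} K′∈ with K′ ≟ˢ K | ∈-filter⁻ (v ∈?_) {xs = maximalCliques G} K′∈
    ... | yes refl | _ = here refl
    ... | no K′≢K  | K′∈mc , v∈K′ =
      there (∈-neighbours⁺ (∈-maximalCliques⁻ K′∈mc) K′≢K v∈K v∈K′)

  cideg≤cdeg+1 : cideg G ≤ cdeg G + 1
  cideg≤cdeg+1 = maxList-≤ (cliquesAt G) (List.allFin n) λ {v} _ → cliquesAt≤cdeg+1 v
    where
    open ≤-Reasoning
    -- Avoids proving that every vertex lies in some maximal clique.
    cliquesAt≤cdeg+1 : ∀ v → cliquesAt G v ≤ cdeg G + 1
    cliquesAt≤cdeg+1 v = length-≤-if-members-≤ λ {K} K∈ → begin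
      cliquesAt G v               ≤⟨ cliquesAt≤1+cliqueGraphDegree K∈ ⟩
      suc (cliqueGraphDegree G K) ≤⟨ s≤s (≤-maxList (cliqueGraphDegree G)
                                      (proj₁ (∈-filter⁻ (v ∈?_) {xs = maximalCliques G} K∈))) ⟩
      suc (cdeg G)                ≡⟨ +-comm 1 (cdeg G) ⟩
      cdeg G + 1                  ∎

  othersContaining : Subset n → Subset n → List (Subset n)
  othersContaining K S = filter (λ K′ → ¬? (K′ ≟ˢ K)) (cliquesContaining S)

  length-othersContaining-class : ∀ {K v} → IsMaximalClique G K → v ∈ K →
    length (othersContaining K (eqClass G v)) ≤ cideg G ∸ 1
  length-othersContaining-class {K} {v} K-max v∈K = ∸-monoˡ-≤ 1 (begin
    suc (length (othersContaining K (eqClass G v)))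
      ≤⟨ length-filter-≢-< _≟ˢ_
           (∈-filter⁺ _ (∈-maximalCliques⁺ K-max) (λ {u} → eqClass-⊆ K-max v∈K {u})) ⟩
    length (cliquesContaining (eqClass G v))
      ≤⟨ unique-⊆⇒length-≤ _≟ˢ_ (Unique.filter⁺ _ maximalCliques-unique) containing⊆through ⟩
    cliquesAt G v
      ≤⟨ ≤-maxList (cliquesAt G) (∈-allFin v) ⟩
    cideg G ∎)
    where
    open ≤-Reasoning
    containing⊆through : cliquesContaining (eqClass G v) ⊆ₗ cliquesThrough v
    containing⊆through K′∈ with ∈-filter⁻ (eqClass G v ⊆?_) {xs = maximalCliques G} K′∈
    ... | K′∈mc , class⊆K′ = ∈-filter⁺ _ K′∈mc (class⊆K′ (v∈eqClass[v] v))

  neighbours⊆othersContainingClasses : ∀ K →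
    neighbours K ⊆ₗ concatMap (othersContaining K) (classes K)
  neighbours⊆othersContainingClasses K {K′} K′∈ with ∈-filter⁻ _ {xs = maximalCliques G} K′∈
  ... | K′∈mc , K′≢K , w , w∈K∩K′ = ∈-concat⁺′ K′∈others (∈-map⁺ (othersContaining K) class∈)
    where
    w∈K  = proj₁ (x∈p∩q⁻ K K′ w∈K∩K′)
    w∈K′ = proj₂ (x∈p∩q⁻ K K′ w∈K∩K′)
    class∈ : eqClass G w ∈ₗ classes K
    class∈ = ∈-filter⁺ _ (∈-allSubsets n (eqClass G w)) (w , w∈K , refl)
    K′∈others : K′ ∈ₗ othersContaining K (eqClass G w)
    K′∈others = ∈-filter⁺ _
      (∈-filter⁺ _ K′∈mc (λ {u} → eqClass-⊆ (∈-maximalCliques⁻ K′∈mc) w∈K′ {u})) K′≢K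

  cliqueGraphDegree≤ : ∀ {K} → IsMaximalClique G K →
    cliqueGraphDegree G K ≤ classesMeeting G K * (cideg G ∸ 1)
  cliqueGraphDegree≤ {K} K-max = begin
    length (neighbours K)
      ≤⟨ unique-⊆⇒length-≤ _≟ˢ_ (Unique.filter⁺ _ maximalCliques-unique)
                              (neighbours⊆othersContainingClasses K) ⟩
    length (concatMap (othersContaining K) (classes K))
      ≤⟨ length-concatMap-≤ (othersContaining K) (cideg G ∸ 1) (classes K) bound ⟩
    classesMeeting G K * (cideg G ∸ 1) ∎
    where
    open ≤-Reasoning
    bound : ∀ {S} → S ∈ₗ classes K → length (othersContaining K S) ≤ cideg G ∸ 1
    bound S∈ with ∈-classes⁻ S∈
    ... | v , v∈K , refl = length-othersContaining-class K-max v∈K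

  cdeg≤ω̃*[cideg∸1] : cdeg G ≤ ω̃ G * (cideg G ∸ 1)
  cdeg≤ω̃*[cideg∸1] = maxList-≤ (cliqueGraphDegree G) (maximalCliques G) λ K∈ →
    ≤-trans (cliqueGraphDegree≤ (∈-maximalCliques⁻ K∈))
            (*-monoˡ-≤ (cideg G ∸ 1) (≤-maxList (classesMeeting G) K∈))

  signature : (K S : Subset n) → Subset (cliqueGraphDegree G K)
  signature K S = Vec.tabulate λ i → does (S ⊆? List.lookup (neighbours K) i)

  signature-⊆ : ∀ {K S T K′} → signature K S ≡ signature K T →
    K′ ∈ₗ neighbours K → S ⊆ K′ → T ⊆ K′
  signature-⊆ {K} {S} {T} sig≡ K′∈ with Any.index K′∈ | lookup-index K′∈
  ... | i | refl = λ S⊆ → does≡true⇒ (T ⊆? _) (trans (≡-sym bit) (dec-true (S ⊆? _) S⊆))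
    where
    open ≡-Reasoning
    bit : does (S ⊆? List.lookup (neighbours K) i) ≡ does (T ⊆? List.lookup (neighbours K) i)
    bit = begin
      does (S ⊆? List.lookup (neighbours K) i) ≡⟨ lookup∘tabulate _ i ⟨
      Vec.lookup (signature K S) i             ≡⟨ cong (λ s → Vec.lookup s i) sig≡ ⟩
      Vec.lookup (signature K T) i             ≡⟨ lookup∘tabulate _ i ⟩
      does (T ⊆? List.lookup (neighbours K) i) ∎

  signature-injective : ∀ {K S T} → S ∈ₗ classes K → T ∈ₗ classes K →
    signature K S ≡ signature K T → S ≡ T
  signature-injective {K} S∈ T∈ sig≡ with ∈-classes⁻ S∈ | ∈-classes⁻ T∈
  ... | v , v∈K , refl | w , w∈K , refl = eqClass-cong λ K″ K″-max →
    follows v∈K w∈K sig≡ K″-max , follows w∈K v∈K (≡-sym sig≡) K″-max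
    where
    follows : ∀ {v w K″} → v ∈ K → w ∈ K →
      signature K (eqClass G v) ≡ signature K (eqClass G w) →
      IsMaximalClique G K″ → v ∈ K″ → w ∈ K″
    follows {w = w} {K″} v∈K w∈K sig≡′ K″-max v∈K″ with K″ ≟ˢ K
    ... | yes refl = w∈K
    ... | no K″≢K  = signature-⊆ sig≡′ (∈-neighbours⁺ K″-max K″≢K v∈K v∈K″)
                       (eqClass-⊆ K″-max v∈K″) (v∈eqClass[v] w)

  classesMeeting≤ : ∀ K → classesMeeting G K ≤ 2 ^ cliqueGraphDegree G K
  classesMeeting≤ K = begin
    length (classes K)
      ≤⟨ length-≤-injection _≟ˢ_ (signature K)
           (Unique.filter⁺ _ (allSubsets-unique n))
           (λ {S} _ → ∈-allSubsets _ (signature K S))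
           signature-injective ⟩
    length (allSubsets (cliqueGraphDegree G K))
      ≡⟨ length-allSubsets (cliqueGraphDegree G K) ⟩
    2 ^ cliqueGraphDegree G K ∎
    where open ≤-Reasoning

  ω̃≤2^cdeg : ω̃ G ≤ 2 ^ cdeg G
  ω̃≤2^cdeg = maxList-≤ (classesMeeting G) (maximalCliques G) λ {K} K∈ →
    ≤-trans (classesMeeting≤ K) (^-monoʳ-≤ 2 (≤-maxList (cliqueGraphDegree G) K∈))

lemma5p3 : ∀ {n : ℕ} (G : Graph n) →
    (cdeg G ≤ ω̃ G * (cideg G ∸ 1)) × (ω̃ G ≤ 2 ^ cdeg G) × (cideg G ≤ cdeg G + 1)
lemma5p3 G = cdeg≤ω̃*[cideg∸1] G , ω̃≤2^cdeg G , cideg≤cdeg+1 G
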